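{- Let $\Delta$ be a simplicial complex with vertex set $[n]=\{1,\dots,n\}$ and let $\Gamma=0*\Delta$ be the cone over $\Delta$ with apex $0$. Let $p$ be a map $\{0,1,\dots,n\}\to\mathbb{R}^d$ with $p(0)=\mathbf{0}$ and, for $i\in[n]$, $p(i)=\begin{bmatrix}\mathbf{v}_i\\ a_i\end{bmatrix}$ with $\mathbf{v}_i\in\mathbb{R}^{d-1}$ and $a_i\in\mathbb{R}\setminus\{0\}$. Define $p':[n]\to\mathbb{R}^{d-1}$ by $p'(i)=\frac{1}{a_i}\mathbf{v}_i$. For a homogeneous polynomial $\lambda(x_0,x_1,\dots,x_n)$ of degree $k$, write $\lambda=\sum_{j=0}^k x_0^j\lambda_j(x_1,\dots,x_n)$. Then: (1) If $\lambda\in\mathrm{Stress}_k(\Gamma,p)$, then $\bar\lambda:=\lambda_0(a_1x_1,\dots,a_nx_n)\in\mathrm{Stress}_k(\Delta,p')$. (2) The linear map $\mathrm{Stress}_k(\Gamma,p)\to\mathrm{Stress}_k(\Delta,p')$, $\lambda(x_0,x_1,\dots,x_n)\mapsto\lambda_0(a_1x_1,\dots,a_nx_n)$, is an isomorphism. In particular, every affine $k$-stress $\omega'$ on $(\Delta,p')$ lifts to an affine $k$-stress $\omega$ on $(\Gamma,p)$ with $\omega'_F=\big(\prod_{i\in F}a_i\big)\omega_F$ for every $(k-1)$-face $F\in\Delta$.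
   Context: The cone $0*\Delta$ is the simplicial complex $\{\sigma,\ \sigma\cup\{0\} : \sigma\in\Delta\}$. A $(k-1)$-face is a face with $k$ elements. Affine stresses: let $\Delta$ be a simplicial complex on vertex set $V$ and $p:V\to\mathbb{R}^m$. Let $\mathbb{R}[X]$ be the polynomial ring in variables $x_v$, $v\in V$. For $i=1,\dots,m$ let $\theta_i=\sum_{v\in V}p(v)_i\,x_v$ and $\theta_{m+1}=\sum_{v\in V}x_v$. For a linear form $\ell=\sum_v\ell_vx_v$ let $\partial_\ell=\sum_v\ell_v\,\partial/\partial x_v$. A homogeneous polynomial $\lambda$ of degree $k$ is an affine $k$-stress on $(\Delta,p)$ if every monomial with nonzero coefficient in $\lambda$ has support (the set of $v$ with $x_v$ dividing it) in $\Delta$, and $\partial_{\theta_i}\lambda=0$ for $i=1,\dots,m+1$. $\mathrm{Stress}_k(\Delta,p)$ denotes the vector space of affine $k$-stresses. For $F\subseteq V$ with $|F|=k$, $\lambda_F$ is the coefficient of $\prod_{v\in F}x_v$ in $\lambda$. -}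

module Defs where

open import Level using (Level)
open import Data.Nat using (ℕ; zero; suc) renaming (_+_ to _+ℕ_)
open import Data.Bool using (Bool; true; false; if_then_else_)
open import Data.Fin using (Fin; zero; suc; fromℕ; inject₁)
open import Data.Vec using (Vec; []; _∷_; lookup; map; _[_]%=_)
open import Data.Fin.Subset using (Subset; _⊆_; ⁅_⁆; ⊥; ∣_∣)
open import Data.Product using (Σ; ∃; _×_; _,_; proj₁)
open import Relation.Nullary using (¬_)
open import Relation.Binary.PropositionalEquality using (_≢_)
open import Algebra.Apartness.Bundles using (HeytingField)

record SimplicialComplex (n : ℕ) : Set₁ where
  field
    face       : Subset n → Set
    empty-face : face ⊥
    down       : ∀ {σ τ} → τ ⊆ σ → face σ → face τ
    vertex     : ∀ i → face ⁅ i ⁆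
open SimplicialComplex public

-- The cone 0 * Δ on vertex set Fin (suc n): vertex zero is the apex 0,
-- vertex (suc i) is the vertex i of Δ.  A subset b ∷ σ is a face iff σ ∈ Δ
-- (b says whether the apex is in it).
coneFace : ∀ {n} → SimplicialComplex n → Subset (suc n) → Set
coneFace Δ (b ∷ σ) = face Δ σ

-- Monomials in variables x_v (v : Fin N) are exponent vectors Vec ℕ N.

deg : ∀ {N} → Vec ℕ N → ℕ
deg []       = 0
deg (x ∷ xs) = x +ℕ deg xs

nz : ℕ → Bool
nz zero    = false
nz (suc _) = true

supp : ∀ {N} → Vec ℕ N → Subset N
supp e = map nz e

sqfree : ∀ {N} → Subset N → Vec ℕ N
sqfree F = map (λ b → if b then 1 else 0) F

module Stresses {c ℓ₁ ℓ₂ : Level} (K : HeytingField c ℓ₁ ℓ₂) where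
  open HeytingField K public using (Carrier; _≈_; _#_; _+_; _*_; 0#; 1#; #⇒invertible)

  Poly : ℕ → Set c
  Poly N = Vec ℕ N → Carrier

  _≈ₚ_ : ∀ {N} → Poly N → Poly N → Set ℓ₁
  f ≈ₚ g = ∀ e → f e ≈ g e

  _+ₚ_ : ∀ {N} → Poly N → Poly N → Poly N
  (f +ₚ g) e = f e + g e

  _·ₚ_ : ∀ {N} → Carrier → Poly N → Poly N
  (x ·ₚ f) e = x * f e

  _×ₙ_ : ℕ → Carrier → Carrier
  zero  ×ₙ x = 0#
  suc m ×ₙ x = x + m ×ₙ x

  _^ₙ_ : Carrier → ℕ → Carrier
  x ^ₙ zero  = 1#
  x ^ₙ suc m = x * x ^ₙ m

  Σ[_] : ∀ {N} → (Fin N → Carrier) → Carrier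
  Σ[_] {zero}  f = 0#
  Σ[_] {suc N} f = f zero + Σ[ (λ v → f (suc v)) ]

  monoVal : ∀ {N} → (Fin N → Carrier) → Vec ℕ N → Carrier
  monoVal a []       = 1#
  monoVal a (m ∷ e)  = a zero ^ₙ m * monoVal (λ v → a (suc v)) e

  prodOver : ∀ {N} → (Fin N → Carrier) → Subset N → Carrier
  prodOver a F = monoVal a (sqfree F)

  -- ∂_ℓ for the linear form ℓ = Σ_v ℓ_v x_v : coefficient of x^e in ∂_ℓ f
  -- is Σ_v ℓ_v (e_v + 1) f_{e + δ_v}
  ∂ : ∀ {N} → (Fin N → Carrier) → Poly N → Poly N
  ∂ ℓ f e = Σ[ (λ v → ℓ v * (suc (lookup e v) ×ₙ f (e [ v ]%= suc))) ]

  Homogeneous : ∀ {N} → ℕ → Poly N → Set ℓ₁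
  Homogeneous k f = ∀ e → deg e ≢ k → f e ≈ 0#

  SupportedOn : ∀ {N} → (Subset N → Set) → Poly N → Set ℓ₁
  SupportedOn fc f = ∀ e → ¬ fc (supp e) → f e ≈ 0#

  IsStress : ∀ {N m} → (Subset N → Set) → (Fin N → Fin m → Carrier)
           → ℕ → Poly N → Set ℓ₁
  IsStress fc p k f =
      Homogeneous k f
    × SupportedOn fc f
    × (∀ i → ∂ (λ v → p v i) f ≈ₚ (λ _ → 0#))
    × ∂ (λ _ → 1#) f ≈ₚ (λ _ → 0#)

  -- the inverse of a nonzero (apart-from-zero) element x, i.e. of x - 0
  inv : ∀ {x} → x # 0# → Carrier
  inv x#0 = proj₁ (#⇒invertible x#0)

  bar : ∀ {n} → (Fin n → Carrier) → Poly (suc n) → Poly n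
  bar a f e = monoVal a e * f (0 ∷ e)

-- Write λ = Σⱼ x₀ʲ λⱼ.  Since p(0) = 0, the coordinate derivations ∂_{θᵢ} never
-- differentiate in x₀, so they act on each slice λⱼ separately, while the affine
-- derivation splits as (j+1) λⱼ₊₁ + ∂₁ λⱼ = 0, where ∂₁ = Σᵢ ∂/∂xᵢ over [n].
-- So a stress on the cone is determined by λ₀, and conversely every λ₀ killed by
-- the coordinate derivations extends through this recurrence to a stress on the
-- cone, because the derivations commute.  Finally, substituting xᵢ ↦ aᵢxᵢ turns
-- ∂_ℓ into ∂_{ℓa}, which trades p′ = v/a for p and ∂₁ for the last coordinate a.
module Submission where

open import Defs
open import Level using (Level)
open import Data.Nat using (ℕ; zero; suc) renaming (_+_ to _+ℕ_; _*_ to _*ℕ_)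
import Data.Nat.Properties as ℕ
open import Data.Bool using (false)
open import Data.Fin using (Fin; zero; suc; fromℕ; inject₁)
open import Data.Fin.Relation.Unary.Top using (view; ‵fromℕ; ‵inject₁)
open import Data.Vec using (Vec; []; _∷_; lookup; _[_]%=_; here; there)
open import Data.Fin.Subset using (Subset; _⊆_; ∣_∣)
open import Data.Product using (Σ; _×_; _,_; proj₁; proj₂)
open import Relation.Binary.PropositionalEquality as ≡ using (_≡_; _≢_)
open import Algebra.Apartness.Bundles using (HeytingField; HeytingCommutativeRing)
open import Algebra.Bundles using (CommutativeRing)
import Algebra.Solver.CommutativeMonoid as CMSolver

incr-comm : ∀ {N} (e : Vec ℕ N) u v →
            (e [ v ]%= suc) [ u ]%= suc ≡ (e [ u ]%= suc) [ v ]%= suc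
incr-comm (x ∷ e) zero    zero    = ≡.refl
incr-comm (x ∷ e) zero    (suc v) = ≡.refl
incr-comm (x ∷ e) (suc u) zero    = ≡.refl
incr-comm (x ∷ e) (suc u) (suc v) = ≡.cong (x ∷_) (incr-comm e u v)

incr-multiplicity-comm : ∀ {N} (e : Vec ℕ N) u v →
  suc (lookup e v) *ℕ suc (lookup (e [ v ]%= suc) u) ≡
  suc (lookup e u) *ℕ suc (lookup (e [ u ]%= suc) v)
incr-multiplicity-comm (x ∷ e) zero    zero    = ≡.refl
incr-multiplicity-comm (x ∷ e) zero    (suc v) = ℕ.*-comm (suc (lookup e v)) (suc x)
incr-multiplicity-comm (x ∷ e) (suc u) zero    = ℕ.*-comm (suc x) (suc (lookup e u))
incr-multiplicity-comm (x ∷ e) (suc u) (suc v) = incr-multiplicity-comm e u v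

deg-incr : ∀ {N} (e : Vec ℕ N) v → deg (e [ v ]%= suc) ≡ suc (deg e)
deg-incr (x ∷ e) zero    = ≡.refl
deg-incr (x ∷ e) (suc v) = ≡.trans (≡.cong (x +ℕ_) (deg-incr e v)) (ℕ.+-suc x (deg e))

supp-incr : ∀ {N} (e : Vec ℕ N) v → supp e ⊆ supp (e [ v ]%= suc)
supp-incr (x     ∷ e) zero    {zero}  _          = here
supp-incr (x     ∷ e) zero    {suc i} (there i∈) = there i∈
supp-incr (zero  ∷ e) (suc v) {zero}  ()
supp-incr (suc x ∷ e) (suc v) {zero}  here       = here
supp-incr (x     ∷ e) (suc v) {suc i} (there i∈) = there (supp-incr e v i∈)

module _ {c ℓ₁ ℓ₂ : Level} (K : HeytingField c ℓ₁ ℓ₂) where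
  open Stresses K hiding (Carrier; _≈_; _#_; _+_; _*_; 0#; 1#; #⇒invertible)
  open HeytingField K hiding (zero)
  private
    R : CommutativeRing c ℓ₁
    R = HeytingCommutativeRing.commutativeRing heytingCommutativeRing
  open CommutativeRing R using (semiring; +-group; *-commutativeMonoid; *-commutativeSemigroup)
  open import Algebra.Properties.Semiring.Mult semiring using (×1-homo-*) renaming (_×_ to _·ₙ_)
  open import Algebra.Properties.Semiring.Sum semiring
    using (sum; sum-cong-≋; sum-replicate-zero; ∑-comm; *-distribˡ-sum)
  open import Algebra.Properties.CommutativeSemigroup *-commutativeSemigroup
    using (interchange; x∙yz≈y∙xz; xy∙z≈xz∙y)
  open import Algebra.Properties.Ring (CommutativeRing.ring R) using (-‿distribˡ-*; -‿distribʳ-*)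
  open import Algebra.Properties.Group +-group using (inverseˡ-unique)
  open import Algebra.Apartness.Properties.HeytingCommutativeRing heytingCommutativeRing using (x-0≈x)
  open CMSolver *-commutativeMonoid using (solve; _⊕_; _⊜_)
  open import Relation.Binary.Reasoning.Setoid setoid

  nat : ℕ → Carrier
  nat m = m ×ₙ 1#

  ×ₙ-as-* : ∀ m x → m ×ₙ x ≈ nat m * x
  ×ₙ-as-* zero    x = sym (zeroˡ x)
  ×ₙ-as-* (suc m) x = begin
    x + m ×ₙ x           ≈⟨ +-cong (sym (*-identityˡ x)) (×ₙ-as-* m x) ⟩
    1# * x + nat m * x   ≈⟨ distribʳ x 1# (nat m) ⟨
    (1# + nat m) * x     ∎

  ×ₙ≡·ₙ : ∀ m x → m ×ₙ x ≡ m ·ₙ x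
  ×ₙ≡·ₙ zero    x = ≡.refl
  ×ₙ≡·ₙ (suc m) x = ≡.cong (x +_) (×ₙ≡·ₙ m x)

  nat-* : ∀ m n → nat (m *ℕ n) ≈ nat m * nat n
  nat-* m n = begin
    nat (m *ℕ n)            ≡⟨ ×ₙ≡·ₙ (m *ℕ n) 1# ⟩
    (m *ℕ n) ·ₙ 1#          ≈⟨ ×1-homo-* m n ⟩
    (m ·ₙ 1#) * (n ·ₙ 1#)   ≡⟨ ≡.cong₂ _*_ (×ₙ≡·ₙ m 1#) (×ₙ≡·ₙ n 1#) ⟨
    nat m * nat n           ∎

  Σ≡sum : ∀ {N} (f : Fin N → Carrier) → Σ[ f ] ≡ sum f
  Σ≡sum {zero}  f = ≡.refl
  Σ≡sum {suc N} f = ≡.cong (f zero +_) (Σ≡sum (λ v → f (suc v)))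

  y≈0⇒x*y≈0 : ∀ x {y} → y ≈ 0# → x * y ≈ 0#
  y≈0⇒x*y≈0 x y≈0 = trans (*-congˡ y≈0) (zeroʳ x)

  inv-inverseˡ : ∀ {x} (x#0 : x # 0#) → inv x#0 * x ≈ 1#
  inv-inverseˡ {x} x#0 = trans (*-congˡ (sym (x-0≈x x))) (proj₁ (proj₂ (#⇒invertible x#0)))

  *-cancelˡ-# : ∀ {x u w} → x # 0# → x * u ≈ x * w → u ≈ w
  *-cancelˡ-# {x} {u} {w} x#0 xu≈xw = begin
    u                   ≈⟨ *-identityˡ u ⟨
    1# * u              ≈⟨ *-congʳ (inv-inverseˡ x#0) ⟨
    inv x#0 * x * u     ≈⟨ *-assoc _ x u ⟩
    inv x#0 * (x * u)   ≈⟨ *-congˡ xu≈xw ⟩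
    inv x#0 * (x * w)   ≈⟨ *-assoc _ x w ⟨
    inv x#0 * x * w     ≈⟨ *-congʳ (inv-inverseˡ x#0) ⟩
    1# * w              ≈⟨ *-identityˡ w ⟩
    w                   ∎

  Annihilates : ∀ {N} → (Fin N → Carrier) → Poly N → Set ℓ₁
  Annihilates ℓ f = ∂ ℓ f ≈ₚ (λ _ → 0#)

  ∂-term : ∀ {N} → (Fin N → Carrier) → Poly N → Vec ℕ N → Fin N → Carrier
  ∂-term ℓ f e v = ℓ v * (nat (suc (lookup e v)) * f (e [ v ]%= suc))

  ∂-as-sum : ∀ {N} (ℓ : Fin N → Carrier) f e → ∂ ℓ f e ≈ sum (∂-term ℓ f e)
  ∂-as-sum ℓ f e = begin
    ∂ ℓ f e                 ≡⟨ Σ≡sum (λ v → ℓ v * (suc (lookup e v) ×ₙ f (e [ v ]%= suc))) ⟩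
    sum (λ v → ℓ v * (suc (lookup e v) ×ₙ f (e [ v ]%= suc)))
                            ≈⟨ sum-cong-≋ (λ v → *-congˡ (×ₙ-as-* (suc (lookup e v)) (f (e [ v ]%= suc)))) ⟩
    sum (∂-term ℓ f e)      ∎

  ∂-cong-at : ∀ {N} (ℓ : Fin N → Carrier) f g e →
    (∀ v → f (e [ v ]%= suc) ≈ g (e [ v ]%= suc)) → ∂ ℓ f e ≈ ∂ ℓ g e
  ∂-cong-at ℓ f g e f≈g = begin
    ∂ ℓ f e              ≈⟨ ∂-as-sum ℓ f e ⟩
    sum (∂-term ℓ f e)   ≈⟨ sum-cong-≋ (λ v → *-congˡ (*-congˡ (f≈g v))) ⟩
    sum (∂-term ℓ g e)   ≈⟨ ∂-as-sum ℓ g e ⟨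
    ∂ ℓ g e              ∎

  ∂-zero-at : ∀ {N} (ℓ : Fin N → Carrier) f e →
    (∀ v → f (e [ v ]%= suc) ≈ 0#) → ∂ ℓ f e ≈ 0#
  ∂-zero-at {N} ℓ f e f≈0 = begin
    ∂ ℓ f e                          ≈⟨ ∂-cong-at ℓ f (λ _ → 0#) e f≈0 ⟩
    ∂ ℓ (λ _ → 0#) e                 ≈⟨ ∂-as-sum ℓ (λ _ → 0#) e ⟩
    sum (∂-term ℓ (λ _ → 0#) e)      ≈⟨ sum-cong-≋ (λ v → trans (*-congˡ (zeroʳ _)) (zeroʳ (ℓ v))) ⟩
    sum {N} (λ _ → 0#)               ≈⟨ sum-replicate-zero N ⟩
    0#                               ∎

  ∂-congˡ : ∀ {N} {ℓ ℓ′ : Fin N → Carrier} → (∀ v → ℓ v ≈ ℓ′ v) → ∀ f → ∂ ℓ f ≈ₚ ∂ ℓ′ f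
  ∂-congˡ {ℓ = ℓ} {ℓ′} ℓ≈ℓ′ f e = begin
    ∂ ℓ f e               ≈⟨ ∂-as-sum ℓ f e ⟩
    sum (∂-term ℓ f e)    ≈⟨ sum-cong-≋ (λ v → *-congʳ (ℓ≈ℓ′ v)) ⟩
    sum (∂-term ℓ′ f e)   ≈⟨ ∂-as-sum ℓ′ f e ⟨
    ∂ ℓ′ f e              ∎

  ∂-·ₚ : ∀ {N} (ℓ : Fin N → Carrier) x f → ∂ ℓ (x ·ₚ f) ≈ₚ (x ·ₚ ∂ ℓ f)
  ∂-·ₚ ℓ x f e = begin
    ∂ ℓ (x ·ₚ f) e                     ≈⟨ ∂-as-sum ℓ (x ·ₚ f) e ⟩
    sum (∂-term ℓ (x ·ₚ f) e)          ≈⟨ sum-cong-≋ (λ v → solve 4 (λ l m x y → l ⊕ (m ⊕ (x ⊕ y)) ⊜ x ⊕ (l ⊕ (m ⊕ y)))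
                                                                refl (ℓ v) _ x _) ⟩
    sum (λ v → x * ∂-term ℓ f e v)     ≈⟨ *-distribˡ-sum x (∂-term ℓ f e) ⟨
    x * sum (∂-term ℓ f e)             ≈⟨ *-congˡ (∂-as-sum ℓ f e) ⟨
    x * ∂ ℓ f e                        ∎

  ∂-supported : ∀ {N} {fc : Subset N → Set} → (∀ {σ τ} → τ ⊆ σ → fc σ → fc τ) →
    ∀ ℓ f → SupportedOn fc f → SupportedOn fc (∂ ℓ f)
  ∂-supported down ℓ f f-supp e e∉ = ∂-zero-at ℓ f e
    (λ v → f-supp (e [ v ]%= suc) (λ e+v∈ → e∉ (down (supp-incr e v) e+v∈)))

  module _ {N} (g : Poly N) (e : Vec ℕ N) where
    private
      ∂∂-term : (Fin N → Carrier) → (Fin N → Carrier) → Fin N → Fin N → Carrier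
      ∂∂-term ℓ m v u = ℓ v * m u *
        (nat (suc (lookup e v) *ℕ suc (lookup (e [ v ]%= suc) u)) * g ((e [ v ]%= suc) [ u ]%= suc))

      ∂∂-as-sum : ∀ ℓ m → ∂ ℓ (∂ m g) e ≈ sum (λ v → sum (∂∂-term ℓ m v))
      ∂∂-as-sum ℓ m = trans (∂-as-sum ℓ (∂ m g) e) (sum-cong-≋ inner)
        where
        inner : ∀ v → ∂-term ℓ (∂ m g) e v ≈ sum (∂∂-term ℓ m v)
        inner v = begin
          ℓ v * (nat A * ∂ m g e′)                      ≈⟨ *-congˡ (*-congˡ (∂-as-sum m g e′)) ⟩
          ℓ v * (nat A * sum (∂-term m g e′))           ≈⟨ *-assoc (ℓ v) (nat A) _ ⟨
          ℓ v * nat A * sum (∂-term m g e′)             ≈⟨ *-distribˡ-sum (ℓ v * nat A) (∂-term m g e′) ⟩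
          sum (λ u → ℓ v * nat A * ∂-term m g e′ u)     ≈⟨ sum-cong-≋ regroup ⟩
          sum (∂∂-term ℓ m v)                           ∎
          where
          A = suc (lookup e v)
          e′ = e [ v ]%= suc
          regroup : ∀ u → ℓ v * nat A * ∂-term m g e′ u ≈ ∂∂-term ℓ m v u
          regroup u = trans
            (solve 5 (λ l a m b x → (l ⊕ a) ⊕ (m ⊕ (b ⊕ x)) ⊜ (l ⊕ m) ⊕ ((a ⊕ b) ⊕ x))
                     refl (ℓ v) (nat A) (m u) (nat (suc (lookup e′ u))) (g (e′ [ u ]%= suc)))
            (*-congˡ (*-congʳ (sym (nat-* A (suc (lookup e′ u))))))

      ∂∂-term-swap : ∀ ℓ m v u → ∂∂-term ℓ m v u ≈ ∂∂-term m ℓ u v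
      ∂∂-term-swap ℓ m v u = *-cong (*-comm (ℓ v) (m u))
        (*-cong (reflexive (≡.cong nat (incr-multiplicity-comm e u v)))
                (reflexive (≡.cong g (incr-comm e u v))))

    ∂-comm : ∀ ℓ m → ∂ ℓ (∂ m g) e ≈ ∂ m (∂ ℓ g) e
    ∂-comm ℓ m = begin
      ∂ ℓ (∂ m g) e                               ≈⟨ ∂∂-as-sum ℓ m ⟩
      sum (λ v → sum (∂∂-term ℓ m v))             ≈⟨ sum-cong-≋ (λ v → sum-cong-≋ (∂∂-term-swap ℓ m v)) ⟩
      sum (λ v → sum (λ u → ∂∂-term m ℓ u v))     ≈⟨ ∑-comm (λ v u → ∂∂-term m ℓ u v) ⟩
      sum (λ u → sum (∂∂-term m ℓ u))             ≈⟨ ∂∂-as-sum m ℓ ⟨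
      ∂ m (∂ ℓ g) e                               ∎

  annihilated-congˡ : ∀ {N} {ℓ ℓ′ : Fin N → Carrier} →
    (∀ v → ℓ v ≈ ℓ′ v) → ∀ f → Annihilates ℓ′ f → Annihilates ℓ f
  annihilated-congˡ ℓ≈ℓ′ f ∂f≈0 e = trans (∂-congˡ ℓ≈ℓ′ f e) (∂f≈0 e)

  ∂-annihilated : ∀ {N} {ℓ : Fin N → Carrier} m f → Annihilates ℓ f → Annihilates ℓ (∂ m f)
  ∂-annihilated {ℓ = ℓ} m f ∂f≈0 e =
    trans (∂-comm f e ℓ m) (∂-zero-at m (∂ ℓ f) e (λ v → ∂f≈0 (e [ v ]%= suc)))

  ·ₚ-annihilated : ∀ {N} {ℓ : Fin N → Carrier} x f → Annihilates ℓ f → Annihilates ℓ (x ·ₚ f)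
  ·ₚ-annihilated {ℓ = ℓ} x f ∂f≈0 e = trans (∂-·ₚ ℓ x f e) (y≈0⇒x*y≈0 x (∂f≈0 e))

  ^ₙ-inverse : ∀ {x y} → x * y ≈ 1# → ∀ m → x ^ₙ m * y ^ₙ m ≈ 1#
  ^ₙ-inverse xy≈1 zero    = *-identityˡ 1#
  ^ₙ-inverse {x} {y} xy≈1 (suc m) = begin
    x * x ^ₙ m * (y * y ^ₙ m)     ≈⟨ interchange x (x ^ₙ m) y (y ^ₙ m) ⟩
    x * y * (x ^ₙ m * y ^ₙ m)     ≈⟨ *-cong xy≈1 (^ₙ-inverse xy≈1 m) ⟩
    1# * 1#                       ≈⟨ *-identityˡ 1# ⟩
    1#                            ∎

  monoVal-inverse : ∀ {N} {a b : Fin N → Carrier} → (∀ v → a v * b v ≈ 1#) →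
    ∀ e → monoVal a e * monoVal b e ≈ 1#
  monoVal-inverse ab≈1 []      = *-identityˡ 1#
  monoVal-inverse {a = a} {b} ab≈1 (m ∷ e) = begin
    a zero ^ₙ m * monoVal a′ e * (b zero ^ₙ m * monoVal b′ e)
      ≈⟨ interchange _ _ _ _ ⟩
    a zero ^ₙ m * b zero ^ₙ m * (monoVal a′ e * monoVal b′ e)
      ≈⟨ *-cong (^ₙ-inverse (ab≈1 zero) m) (monoVal-inverse (λ v → ab≈1 (suc v)) e) ⟩
    1# * 1#
      ≈⟨ *-identityˡ 1# ⟩
    1# ∎
    where
    a′ b′ : Fin _ → Carrier
    a′ v = a (suc v)
    b′ v = b (suc v)

  monoVal-incr : ∀ {N} (a : Fin N → Carrier) e v → monoVal a (e [ v ]%= suc) ≈ a v * monoVal a e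
  monoVal-incr a (m ∷ e) zero    = *-assoc (a zero) (a zero ^ₙ m) _
  monoVal-incr a (m ∷ e) (suc v) = trans (*-congˡ (monoVal-incr (λ w → a (suc w)) e v))
    (x∙yz≈y∙xz _ _ _)

  rescale : ∀ {N} → (Fin N → Carrier) → Poly N → Poly N
  rescale a g e = monoVal a e * g e

  rescale-inverse : ∀ {N} {a b : Fin N → Carrier} → (∀ v → b v * a v ≈ 1#) →
    ∀ g → rescale b (rescale a g) ≈ₚ g
  rescale-inverse {a = a} {b} ba≈1 g e = begin
    monoVal b e * (monoVal a e * g e)   ≈⟨ *-assoc _ _ (g e) ⟨
    monoVal b e * monoVal a e * g e     ≈⟨ *-congʳ (monoVal-inverse ba≈1 e) ⟩
    1# * g e                            ≈⟨ *-identityˡ (g e) ⟩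
    g e                                 ∎

  ∂-rescale : ∀ {N} (a ℓ : Fin N → Carrier) g →
    ∂ ℓ (rescale a g) ≈ₚ rescale a (∂ (λ v → ℓ v * a v) g)
  ∂-rescale a ℓ g e = begin
    ∂ ℓ (rescale a g) e                               ≈⟨ ∂-as-sum ℓ (rescale a g) e ⟩
    sum (∂-term ℓ (rescale a g) e)                    ≈⟨ sum-cong-≋ regroup ⟩
    sum (λ v → monoVal a e * ∂-term ℓa g e v)        ≈⟨ *-distribˡ-sum (monoVal a e) (∂-term ℓa g e) ⟨
    monoVal a e * sum (∂-term ℓa g e)                 ≈⟨ *-congˡ (∂-as-sum ℓa g e) ⟨
    monoVal a e * ∂ ℓa g e                            ∎
    where
    ℓa : Fin _ → Carrier
    ℓa v = ℓ v * a v
    regroup : ∀ v → ∂-term ℓ (rescale a g) e v ≈ monoVal a e * ∂-term ℓa g e v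
    regroup v = trans (*-congˡ (*-congˡ (*-congʳ (monoVal-incr a e v))))
      (solve 5 (λ l n x m y → l ⊕ (n ⊕ ((x ⊕ m) ⊕ y)) ⊜ m ⊕ ((l ⊕ x) ⊕ (n ⊕ y)))
               refl (ℓ v) (nat (suc (lookup e v))) (a v) (monoVal a e) (g (e [ v ]%= suc)))

  rescale-annihilated : ∀ {N} {ℓ : Fin N → Carrier} a g →
    Annihilates (λ v → ℓ v * a v) g → Annihilates ℓ (rescale a g)
  rescale-annihilated {ℓ = ℓ} a g ∂g≈0 e =
    trans (∂-rescale a ℓ g e) (y≈0⇒x*y≈0 (monoVal a e) (∂g≈0 e))

  one : ∀ {N} → Fin N → Carrier
  one _ = 1#

  slice : ∀ {N} → Poly (suc N) → ℕ → Poly N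
  slice f j e = f (j ∷ e)

  -- ∂ ℓ f (j ∷ e) unfolds to ℓ zero * (suc j ×ₙ f (suc j ∷ e)) + ∂ (ℓ ∘ suc) (slice f j) e.
  ∂-apex-free : ∀ {N} (ℓ : Fin (suc N) → Carrier) → ℓ zero ≈ 0# → ∀ f j e →
    ∂ ℓ f (j ∷ e) ≈ ∂ (λ v → ℓ (suc v)) (slice f j) e
  ∂-apex-free ℓ ℓ₀≈0 f j e = trans (+-congʳ (trans (*-congʳ ℓ₀≈0) (zeroˡ _))) (+-identityˡ _)

  slice-annihilated : ∀ {N} (ℓ : Fin (suc N) → Carrier) → ℓ zero ≈ 0# → ∀ f →
    Annihilates ℓ f → ∀ j → Annihilates (λ v → ℓ (suc v)) (slice f j)
  slice-annihilated ℓ ℓ₀≈0 f ∂f≈0 j e = trans (sym (∂-apex-free ℓ ℓ₀≈0 f j e)) (∂f≈0 (j ∷ e))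

  annihilated-by-slices : ∀ {N} (ℓ : Fin (suc N) → Carrier) → ℓ zero ≈ 0# → ∀ f →
    (∀ j → Annihilates (λ v → ℓ (suc v)) (slice f j)) → Annihilates ℓ f
  annihilated-by-slices ℓ ℓ₀≈0 f ∂fⱼ≈0 (j ∷ e) = trans (∂-apex-free ℓ ℓ₀≈0 f j e) (∂fⱼ≈0 j e)

  ∂-one-cone : ∀ {N} (f : Poly (suc N)) j e →
    ∂ one f (j ∷ e) ≈ nat (suc j) * f (suc j ∷ e) + ∂ one (slice f j) e
  ∂-one-cone f j e = +-congʳ (trans (*-identityˡ _) (×ₙ-as-* (suc j) (f (suc j ∷ e))))

  slice-recurrence : ∀ {N} (f : Poly (suc N)) → Annihilates one f →
    ∀ j e → nat (suc j) * f (suc j ∷ e) ≈ - ∂ one (slice f j) e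
  slice-recurrence f ∂f≈0 j e =
    inverseˡ-unique _ _ (trans (sym (∂-one-cone f j e)) (∂f≈0 (j ∷ e)))

  annihilated-by-recurrence : ∀ {N} (f : Poly (suc N)) →
    (∀ j e → nat (suc j) * f (suc j ∷ e) ≈ - ∂ one (slice f j) e) → Annihilates one f
  annihilated-by-recurrence f rec (j ∷ e) =
    trans (∂-one-cone f j e) (trans (+-congʳ (rec j e)) (-‿inverseˡ _))

  slices-determined : (∀ m → nat (suc m) # 0#) → ∀ {N} {f g : Poly (suc N)} →
    Annihilates one f → Annihilates one g → slice f 0 ≈ₚ slice g 0 → f ≈ₚ g
  slices-determined char0 {f = f} {g} ∂f≈0 ∂g≈0 f₀≈g₀ (j ∷ e) = agree j e
    where
    agree : ∀ j → slice f j ≈ₚ slice g j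
    agree zero    = f₀≈g₀
    agree (suc j) e = *-cancelˡ-# (char0 j) (begin
      nat (suc j) * f (suc j ∷ e)   ≈⟨ slice-recurrence f ∂f≈0 j e ⟩
      - ∂ one (slice f j) e         ≈⟨ -‿cong (∂-cong-at one (slice f j) (slice g j) e
                                                 (λ v → agree j (e [ v ]%= suc))) ⟩
      - ∂ one (slice g j) e         ≈⟨ slice-recurrence g ∂g≈0 j e ⟨
      nat (suc j) * g (suc j ∷ e)   ∎)

  module Lift (char0 : ∀ m → nat (suc m) # 0#) {N} (g : Poly N) where

    layer : ℕ → Poly N
    layer zero    = g
    layer (suc j) = (- inv (char0 j)) ·ₚ ∂ one (layer j)

    extend : Poly (suc N)
    extend (j ∷ e) = layer j e

    layer-recurrence : ∀ j e → nat (suc j) * layer (suc j) e ≈ - ∂ one (layer j) e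
    layer-recurrence j e = begin
      n * (- n⁻¹ * X)   ≈⟨ *-congˡ (-‿distribˡ-* n⁻¹ X) ⟨
      n * - (n⁻¹ * X)   ≈⟨ -‿distribʳ-* n (n⁻¹ * X) ⟨
      - (n * (n⁻¹ * X)) ≈⟨ -‿cong (*-assoc n n⁻¹ X) ⟨
      - (n * n⁻¹ * X)   ≈⟨ -‿cong (*-congʳ (trans (*-comm n n⁻¹) (inv-inverseˡ (char0 j)))) ⟩
      - (1# * X)        ≈⟨ -‿cong (*-identityˡ X) ⟩
      - X               ∎
      where
      n = nat (suc j)
      n⁻¹ = inv (char0 j)
      X = ∂ one (layer j) e

    layer-annihilated : ∀ {ℓ} → Annihilates ℓ g → ∀ j → Annihilates ℓ (layer j)
    layer-annihilated ∂g≈0 zero    = ∂g≈0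
    layer-annihilated ∂g≈0 (suc j) =
      ·ₚ-annihilated (- inv (char0 j)) (∂ one (layer j))
        (∂-annihilated one (layer j) (layer-annihilated ∂g≈0 j))

    layer-homogeneous : ∀ {k} → Homogeneous k g → ∀ j e → j +ℕ deg e ≢ k → layer j e ≈ 0#
    layer-homogeneous g-hom zero    e ≢k = g-hom e ≢k
    layer-homogeneous g-hom (suc j) e ≢k = y≈0⇒x*y≈0 _ (∂-zero-at one (layer j) e
      (λ v → layer-homogeneous g-hom j (e [ v ]%= suc) (λ ≡k → ≢k (≡.trans (≡.sym (shift v)) ≡k))))
      where
      shift : ∀ v → j +ℕ deg (e [ v ]%= suc) ≡ suc j +ℕ deg e
      shift v = ≡.trans (≡.cong (j +ℕ_) (deg-incr e v)) (ℕ.+-suc j (deg e))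

    layer-supported : ∀ {fc : Subset N → Set} → (∀ {σ τ} → τ ⊆ σ → fc σ → fc τ) →
      SupportedOn fc g → ∀ j → SupportedOn fc (layer j)
    layer-supported down g-supp zero    = g-supp
    layer-supported down g-supp (suc j) e e∉ =
      y≈0⇒x*y≈0 _ (∂-supported down one (layer j) (layer-supported down g-supp j) e e∉)

    extend-annihilated-by-one : Annihilates one extend
    extend-annihilated-by-one = annihilated-by-recurrence extend layer-recurrence

  bar-+ₚ : ∀ {N} (a : Fin N → Carrier) f g → bar a (f +ₚ g) ≈ₚ (bar a f +ₚ bar a g)
  bar-+ₚ a f g e = distribˡ (monoVal a e) (f (0 ∷ e)) (g (0 ∷ e))

  bar-·ₚ : ∀ {N} (a : Fin N → Carrier) x f → bar a (x ·ₚ f) ≈ₚ (x ·ₚ bar a f)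
  bar-·ₚ a x f e = x∙yz≈y∙xz (monoVal a e) x (f (0 ∷ e))

  module Cone {n d : ℕ} (Δ : SimplicialComplex n) (p : Fin (suc n) → Fin (suc d) → Carrier)
              (apex : ∀ j → p zero j ≈ 0#) (a#0 : ∀ i → p (suc i) (fromℕ d) # 0#) where

    a a⁻¹ : Fin n → Carrier
    a i = p (suc i) (fromℕ d)
    a⁻¹ i = inv (a#0 i)

    p′ : Fin n → Fin d → Carrier
    p′ i j = inv (a#0 i) * p (suc i) (inject₁ j)

    a⁻¹*a≈1 : ∀ v → a⁻¹ v * a v ≈ 1#
    a⁻¹*a≈1 v = inv-inverseˡ (a#0 v)

    a*a⁻¹≈1 : ∀ v → a v * a⁻¹ v ≈ 1#
    a*a⁻¹≈1 v = trans (*-comm (a v) (a⁻¹ v)) (a⁻¹*a≈1 v)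

    p′*a≈p : ∀ i v → p′ v i * a v ≈ p (suc v) (inject₁ i)
    p′*a≈p i v = begin
      a⁻¹ v * p (suc v) (inject₁ i) * a v   ≈⟨ xy∙z≈xz∙y (a⁻¹ v) _ (a v) ⟩
      a⁻¹ v * a v * p (suc v) (inject₁ i)   ≈⟨ *-congʳ (a⁻¹*a≈1 v) ⟩
      1# * p (suc v) (inject₁ i)            ≈⟨ *-identityˡ _ ⟩
      p (suc v) (inject₁ i)                 ∎

    bar-isStress : ∀ {k} f → IsStress (coneFace Δ) p k f → IsStress (face Δ) p′ k (bar a f)
    bar-isStress f (f-hom , f-supp , ∂f≈0 , ∂₁f≈0) =
        (λ e ≢k → y≈0⇒x*y≈0 (monoVal a e) (f-hom (0 ∷ e) ≢k))
      , (λ e e∉ → y≈0⇒x*y≈0 (monoVal a e) (f-supp (0 ∷ e) e∉))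
      , (λ i → rescale-annihilated a (slice f 0) (annihilated-congˡ (p′*a≈p i) (slice f 0)
                 (slice-annihilated (λ v → p v (inject₁ i)) (apex (inject₁ i)) f (∂f≈0 (inject₁ i)) 0)))
      , rescale-annihilated a (slice f 0) (annihilated-congˡ (λ v → *-identityˡ (a v)) (slice f 0)
          (slice-annihilated (λ v → p v (fromℕ d)) (apex (fromℕ d)) f (∂f≈0 (fromℕ d)) 0))

    bar-injective : (∀ m → nat (suc m) # 0#) → ∀ {k} f g →
      IsStress (coneFace Δ) p k f → IsStress (coneFace Δ) p k g → bar a f ≈ₚ bar a g → f ≈ₚ g
    bar-injective char0 f g (_ , _ , _ , ∂₁f≈0) (_ , _ , _ , ∂₁g≈0) f̄≈ḡ =
      slices-determined char0 ∂₁f≈0 ∂₁g≈0 λ e → begin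
        f (0 ∷ e)                  ≈⟨ rescale-inverse a⁻¹*a≈1 (slice f 0) e ⟨
        rescale a⁻¹ (bar a f) e    ≈⟨ *-congˡ (f̄≈ḡ e) ⟩
        rescale a⁻¹ (bar a g) e    ≈⟨ rescale-inverse a⁻¹*a≈1 (slice g 0) e ⟩
        g (0 ∷ e)                  ∎

    module _ (char0 : ∀ m → nat (suc m) # 0#) (ω′ : Poly n) where
      open Lift char0 (rescale a⁻¹ ω′)

      lift : Poly (suc n)
      lift = extend

      lift-isStress : ∀ {k} → IsStress (face Δ) p′ k ω′ → IsStress (coneFace Δ) p k lift
      lift-isStress (ω′-hom , ω′-supp , ∂ω′≈0 , ∂₁ω′≈0) =
          (λ { (j ∷ e) → layer-homogeneous (λ e ≢k → y≈0⇒x*y≈0 (monoVal a⁻¹ e) (ω′-hom e ≢k)) j e })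
        , (λ { (j ∷ e) → layer-supported (down Δ) (λ e e∉ → y≈0⇒x*y≈0 (monoVal a⁻¹ e) (ω′-supp e e∉)) j e })
        , (λ i → annihilated-by-slices (λ v → p v i) (apex i) extend
                   (layer-annihilated (coordinate-annihilates i)))
        , extend-annihilated-by-one
        where
        coordinate-annihilates : ∀ i → Annihilates (λ v → p (suc v) i) (rescale a⁻¹ ω′)
        coordinate-annihilates i with view i
        ... | ‵fromℕ      = rescale-annihilated a⁻¹ ω′ (annihilated-congˡ a*a⁻¹≈1 ω′ ∂₁ω′≈0)
        ... | ‵inject₁ i′ = rescale-annihilated a⁻¹ ω′
                (annihilated-congˡ (λ v → *-comm (p (suc v) (inject₁ i′)) (a⁻¹ v)) ω′ (∂ω′≈0 i′))

      bar-lift : bar a lift ≈ₚ ω′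
      bar-lift = rescale-inverse a*a⁻¹≈1 ω′

      -- sqfree (false ∷ F) is 0 ∷ sqfree F, so the right-hand side is bar a lift (sqfree F);
      -- in particular it holds for all F, not only for (k-1)-faces.
      lift-coefficient : ∀ F → ω′ (sqfree F) ≈ prodOver a F * lift (sqfree (false ∷ F))
      lift-coefficient F = sym (bar-lift (sqfree F))

lemma3p2 : ∀ {c ℓ₁ ℓ₂ : Level} (K : HeytingField c ℓ₁ ℓ₂) →
  let open Stresses K
  in
  -- K has characteristic 0 (as ℝ does)
  (∀ m → (suc m ×ₙ 1#) # 0#) →
  ∀ (n d k : ℕ) (Δ : SimplicialComplex n)
    (p : Fin (suc n) → Fin (suc d) → Carrier) →
  (∀ j → p zero j ≈ 0#) →
  let a : Fin n → Carrier
      a i = p (suc i) (fromℕ d)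
  in
  (a#0 : ∀ i → a i # 0#) →
  let p′ : Fin n → Fin d → Carrier
      p′ i j = inv (a#0 i) * p (suc i) (inject₁ j)
      Γ = coneFace Δ
  in
  -- (1)
  (∀ (λ′ : Poly (suc n)) → IsStress Γ p k λ′ → IsStress (face Δ) p′ k (bar a λ′))
  -- (2) the map is linear ...
  × (∀ (f g : Poly (suc n)) → bar a (f +ₚ g) ≈ₚ (bar a f +ₚ bar a g))
  × (∀ (x : Carrier) (f : Poly (suc n)) → bar a (x ·ₚ f) ≈ₚ (x ·ₚ bar a f))
  -- ... injective on Stress_k(Γ, p) ...
  × (∀ (f g : Poly (suc n)) → IsStress Γ p k f → IsStress Γ p k g →
       bar a f ≈ₚ bar a g → f ≈ₚ g)
  -- ... and onto Stress_k(Δ, p′)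
  × (∀ (ω′ : Poly n) → IsStress (face Δ) p′ k ω′ →
       Σ (Poly (suc n)) (λ ω → IsStress Γ p k ω × bar a ω ≈ₚ ω′))
  -- in particular: lifts with ω′_F = (∏_{i∈F} a_i) ω_F for (k-1)-faces F
  × (∀ (ω′ : Poly n) → IsStress (face Δ) p′ k ω′ →
       Σ (Poly (suc n)) (λ ω → IsStress Γ p k ω ×
         (∀ (F : Subset n) → face Δ F → ∣ F ∣ ≡ k →
            ω′ (sqfree F) ≈ prodOver a F * ω (sqfree (false ∷ F)))))
lemma3p2 K char0 n d k Δ p apex a#0 =
    bar-isStress
  , bar-+ₚ K a
  , bar-·ₚ K a
  , bar-injective char0
  , (λ ω′ ω′-stress → lift char0 ω′ , lift-isStress char0 ω′ ω′-stress , bar-lift char0 ω′)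
  , (λ ω′ ω′-stress → lift char0 ω′ , lift-isStress char0 ω′ ω′-stress ,
                      λ F _ _ → lift-coefficient char0 ω′ F)
  where open Cone K Δ p apex a#0
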